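{- For $n\geqslant 2$, the map $\phi:V(\text{CQ}_n)\to V(\text{CQ}_n)$, $\phi(u)=f_{n-1}(u)$, is an automorphism of $\text{CQ}_n$.
   Context: Two 2-bit strings $x_2x_1$ and $y_2y_1$ are pair related, written $x_2x_1\sim y_2y_1$, iff $(x_2x_1,y_2y_1)\in\{(00,00),(10,10),(01,11),(11,01)\}$. The $n$-dimensional crossed cube $\text{CQ}_n$ has as vertices all binary strings $u=u_{n-1}\ldots u_0$ of length $n$. Two vertices $u,v$ are adjacent iff there is an index $x$ with $0\leqslant x\leqslant n-1$ such that: (1) $v_x\neq u_x$; (2) if $x$ is odd, $v_{x-1}=u_{x-1}$; (3) $v_i=u_i$ for all $i>x$; (4) $u_{2i+1}u_{2i}\sim v_{2i+1}v_{2i}$ for all $0\leqslant i\leqslant\lfloor x/2\rfloor-1$. For $0\leqslant i\leqslant n-1$, $f_i(u)$ denotes the string obtained from $u$ by negating the bit $u_i$. -}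

module Defs where

open import Data.Nat using (ℕ; zero; suc; _+_; _*_; _<_; _%_)
open import Data.Bool using (Bool; true; false; not)
open import Data.Fin using (Fin; toℕ; fromℕ<)
open import Data.Vec using (Vec; lookup; _[_]%=_)
open import Data.Empty using (⊥)
open import Data.Product using (∃; _×_)
open import Relation.Binary.PropositionalEquality using (_≡_)
open import Function.Definitions using (Bijective)
open import Function.Bundles using (_⇔_)

-- A vertex of CQ_n: a binary string u = u_{n-1} … u_0; bit u_i is  lookup u i.
Vertex : ℕ → Set
Vertex n = Vec Bool n

-- Pair relation on 2-bit strings x₂x₁ ∼ y₂y₁ (arguments in the order x₂ x₁ y₂ y₁),
-- with 0 = false, 1 = true.
data PairRel : Bool → Bool → Bool → Bool → Set where
  r00-00 : PairRel false false false false
  r10-10 : PairRel true  false true  false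
  r01-11 : PairRel false true  true  true
  r11-01 : PairRel true  true  false true

Odd : ℕ → Set
Odd k = k % 2 ≡ 1

AdjVia : (n : ℕ) → Vertex n → Vertex n → Fin n → Set
AdjVia n u v x =
  (lookup v x ≡ lookup u x → ⊥)
  ×
  ((j : Fin n) → Odd (toℕ x) → suc (toℕ j) ≡ toℕ x → lookup v j ≡ lookup u j)
  ×
  ((i : Fin n) → toℕ x < toℕ i → lookup v i ≡ lookup u i)
  × -- (4) u_{2i+1}u_{2i} ∼ v_{2i+1}v_{2i} for 0 ≤ i ≤ ⌊x/2⌋ - 1, i.e. 2i+1 < x
  ((i : ℕ) (p : suc (2 * i) < n) (q : 2 * i < n) → suc (2 * i) < toℕ x →
     PairRel (lookup u (fromℕ< p)) (lookup u (fromℕ< q))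
             (lookup v (fromℕ< p)) (lookup v (fromℕ< q)))

Adjacent : (n : ℕ) → Vertex n → Vertex n → Set
Adjacent n u v = ∃ λ (x : Fin n) → AdjVia n u v x

flipBit : {n : ℕ} → Fin n → Vertex n → Vertex n
flipBit i u = u [ i ]%= not

IsAutomorphism : (n : ℕ) → (Vertex n → Vertex n) → Set
IsAutomorphism n φ =
  Bijective _≡_ _≡_ φ × ((u v : Vertex n) → Adjacent n u v ⇔ Adjacent n (φ u) (φ v))

-- Conditions (2) and (4) of adjacency via index x only inspect bits below x, and x ≤ n − 1,
-- so they never see the top bit; conditions (1) and (3) only ask whether u and v agree at a
-- bit, which flipping the same bit of both does not change. Hence f_{n−1} preserves
-- adjacency, and being an involution it is its own inverse.
module Submission where

open import Defs
open import Data.Nat using (ℕ; suc; _<_; _*_)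
open import Data.Nat.Properties using (<⇒≱; n<1+n; <-trans; ≤-reflexive)
open import Data.Fin using (Fin; fromℕ; toℕ; fromℕ<; _≟_)
open import Data.Fin.Properties using (≤fromℕ; toℕ-fromℕ<)
open import Data.Bool using (not)
open import Data.Vec using (lookup)
open import Data.Vec.Properties using (lookup∘updateAt; lookup∘updateAt′; updateAt-updateAt; updateAt-id-local)
open import Data.Bool.Properties using (not-involutive)
open import Data.Product using (_,_)
open import Relation.Nullary using (yes; no)
open import Relation.Binary.PropositionalEquality
open import Function.Bundles using (mk⇔)
open import Function.Consequences using (inverseᵇ⇒bijective)
open import Function.Consequences.Propositional using (strictlyInverseˡ⇒inverseˡ; strictlyInverseʳ⇒inverseʳ)

involutive⇒automorphism : ∀ n (φ : Vertex n → Vertex n) → (∀ u → φ (φ u) ≡ u) →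
                          (∀ u v → Adjacent n u v → Adjacent n (φ u) (φ v)) →
                          IsAutomorphism n φ
involutive⇒automorphism n φ φ∘φ≡id preserves =
    inverseᵇ⇒bijective _≡_ refl sym trans
      (strictlyInverseˡ⇒inverseˡ φ φ∘φ≡id , strictlyInverseʳ⇒inverseʳ φ φ∘φ≡id)
  , λ u v → mk⇔ (preserves u v) (reflects u v)
  where
  reflects : ∀ u v → Adjacent n (φ u) (φ v) → Adjacent n u v
  reflects u v adj = subst₂ (Adjacent n) (φ∘φ≡id u) (φ∘φ≡id v) (preserves (φ u) (φ v) adj)

module _ {n : ℕ} (i : Fin n) where

  flipBit-involutive : ∀ u → flipBit i (flipBit i u) ≡ u
  flipBit-involutive u = trans (updateAt-updateAt i u) (updateAt-id-local i u (not-involutive _))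

  flipBit-preserves-agreement : ∀ u v k → lookup v k ≡ lookup u k →
                                lookup (flipBit i v) k ≡ lookup (flipBit i u) k
  flipBit-preserves-agreement u v k vₖ≡uₖ with k ≟ i
  ... | yes refl = begin
    lookup (flipBit i v) i  ≡⟨ lookup∘updateAt i v ⟩
    not (lookup v i)        ≡⟨ cong not vₖ≡uₖ ⟩
    not (lookup u i)        ≡⟨ lookup∘updateAt i u ⟨
    lookup (flipBit i u) i  ∎
    where open ≡-Reasoning
  ... | no k≢i = begin
    lookup (flipBit i v) k  ≡⟨ lookup∘updateAt′ k i k≢i v ⟩
    lookup v k              ≡⟨ vₖ≡uₖ ⟩
    lookup u k              ≡⟨ lookup∘updateAt′ k i k≢i u ⟨
    lookup (flipBit i u) k  ∎
    where open ≡-Reasoning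

  flipBit-reflects-agreement : ∀ u v k → lookup (flipBit i v) k ≡ lookup (flipBit i u) k →
                               lookup v k ≡ lookup u k
  flipBit-reflects-agreement u v k agree =
    subst₂ (λ v′ u′ → lookup v′ k ≡ lookup u′ k) (flipBit-involutive v) (flipBit-involutive u)
      (flipBit-preserves-agreement (flipBit i u) (flipBit i v) k agree)

flipBit-top-fixes-below : ∀ {n} {k x : Fin (suc n)} (u : Vertex (suc n)) → toℕ k < toℕ x →
                          lookup (flipBit (fromℕ n) u) k ≡ lookup u k
flipBit-top-fixes-below {n} {k} {x} u k<x = lookup∘updateAt′ k (fromℕ n) k≢top u
  where
  k≢top : k ≢ fromℕ n
  k≢top refl = <⇒≱ k<x (≤fromℕ x)

AdjVia-flipBit-top : ∀ {n} (u v : Vertex (suc n)) (x : Fin (suc n)) → AdjVia (suc n) u v x →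
                     AdjVia (suc n) (flipBit (fromℕ n) u) (flipBit (fromℕ n) v) x
AdjVia-flipBit-top {n} u v x (flipped , pairedBit , aboveEqual , pairs) =
    (λ agree → flipped (flipBit-reflects-agreement top u v x agree))
  , pairedBit′
  , (λ i x<i → flipBit-preserves-agreement top u v i (aboveEqual i x<i))
  , pairs′
  where
  top : Fin (suc n)
  top = fromℕ n

  φ : Vertex (suc n) → Vertex (suc n)
  φ = flipBit top

  fixes : ∀ w {j} (j<n : j < suc n) → j < toℕ x → lookup (φ w) (fromℕ< j<n) ≡ lookup w (fromℕ< j<n)
  fixes w j<n j<x = flipBit-top-fixes-below w (subst (_< toℕ x) (sym (toℕ-fromℕ< j<n)) j<x)

  pairedBit′ : ∀ j → Odd (toℕ x) → suc (toℕ j) ≡ toℕ x → lookup (φ v) j ≡ lookup (φ u) j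
  pairedBit′ j odd j+1≡x
    rewrite flipBit-top-fixes-below u (≤-reflexive j+1≡x)
          | flipBit-top-fixes-below v (≤-reflexive j+1≡x) = pairedBit j odd j+1≡x

  pairs′ : ∀ i p q → suc (2 * i) < toℕ x →
           PairRel (lookup (φ u) (fromℕ< p)) (lookup (φ u) (fromℕ< q))
                   (lookup (φ v) (fromℕ< p)) (lookup (φ v) (fromℕ< q))
  pairs′ i p q 2i+1<x
    rewrite fixes u p 2i+1<x | fixes v p 2i+1<x
          | fixes u q (<-trans (n<1+n _) 2i+1<x) | fixes v q (<-trans (n<1+n _) 2i+1<x)
    = pairs i p q 2i+1<x

flipBit-top-automorphism : ∀ n → IsAutomorphism (suc n) (flipBit (fromℕ n))
flipBit-top-automorphism n =
  involutive⇒automorphism (suc n) (flipBit (fromℕ n)) (flipBit-involutive (fromℕ n))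
    λ { u v (x , adj) → x , AdjVia-flipBit-top u v x adj }

lemma2 : (m : ℕ) → IsAutomorphism (suc (suc m)) (flipBit (fromℕ (suc m)))
lemma2 m = flipBit-top-automorphism (suc m)
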